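{- The category of models of $\mathrm{Syn}(\mathsf{Glob})$ is equivalent to the category of models of $\mathrm{Syn}(\mathsf{Glob}_{\mathbf 1})$.
   Context: Type-theoretic conventions. Raw contexts are finite lists $(x_1:A_1,\dots,x_n:A_n)$ of distinct variables with types; raw substitutions are lists $\langle x_1\mapsto t_1,\dots,x_n\mapsto t_n\rangle$; judgments $\Gamma\vdash$, $\Gamma\vdash A$, $\Gamma\vdash t:A$, $\Delta\vdash\sigma:\Gamma$. Common rules: $\varnothing\vdash$; from $\Gamma\vdash A$ with $x$ fresh infer $(\Gamma,x:A)\vdash$; from $\Gamma\vdash$ and $(x:A)\in\Gamma$ infer $\Gamma\vdash x:A$; from $\Delta\vdash$ infer $\Delta\vdash\langle\rangle:\varnothing$; from $\Delta\vdash\sigma:\Gamma$, $(\Gamma,x:A)\vdash$, $\Delta\vdash t:A[\sigma]$ infer $\Delta\vdash\langle\sigma,x\mapsto t\rangle:(\Gamma,x:A)$. Substitution action on variables: $x[\langle\rangle]=x$, $x[\langle\sigma,y\mapsto t\rangle]=t$ if $x=y$ else $x[\sigma]$; composition $\langle\sigma,x\mapsto t\rangle\circ\delta=\langle\sigma\circ\delta,x\mapsto t[\delta]\rangle$, $\langle\rangle\circ\delta=\langle\rangle$. The syntactic category $\mathrm{Syn}(T)$: derivable contexts as objects, derivable substitutions $\Delta\vdash\sigma:\Gamma$ as morphisms $\Delta\to\Gamma$ (up to definitional equality if $T$ has one); it is a category with families with types/terms over $\Gamma$ the derivable ones, terminal object $\varnothing$, comprehension $(\Gamma,x:A)$ and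 display maps the projections $(\Gamma,x:A)\to\Gamma$. $\mathsf{Glob}$: types $\star$ and $\mathrm{Hom}_A\,t\,u$, with $\star[\sigma]=\star$, $(\mathrm{Hom}_Atu)[\sigma]=\mathrm{Hom}_{A[\sigma]}t[\sigma]u[\sigma]$; the only terms are variables; rules: $\Gamma\vdash$ gives $\Gamma\vdash\star$; $\Gamma\vdash t:A$ and $\Gamma\vdash u:A$ give $\Gamma\vdash\mathrm{Hom}_Atu$. $\mathsf{Glob}_{\mathbf 1}$: types $\mathbf 1$ and $\mathrm{Hom}_A\,t\,u$; terms are variables and the constant $()$, with $\mathbf 1[\sigma]=\mathbf 1$, $()[\sigma]=()$; rules: $\Gamma\vdash$ gives $\Gamma\vdash\mathbf 1$ and $\Gamma\vdash():\mathbf 1$; $\Gamma\vdash A$, $\Gamma\vdash t:A$, $\Gamma\vdash u:A$ give $\Gamma\vdash\mathrm{Hom}_Atu$; definitional equality: if $\Gamma\vdash t:A$ and $A\equiv B$ then $\Gamma\vdash t:B$, and if $\Gamma\vdash t:\mathbf 1$ then $t\equiv()$. In $\mathsf{Glob}_{\mathbf 1}$, $\star$ denotes $\mathrm{Hom}_{\mathbf 1}()()$, so every $\mathsf{Glob}$ expression is read as a $\mathsf{Glob}_{\mathbf 1}$ expression. A model of a category with families $C$ is a functor $C\to\mathbf{Set}$ preserving the terminal object and sending pullback squares along display maps (the squares $(\Delta,x:A[f])\to(\Gamma,x:A)$ over $f:\Delta\to\Gamma$) to pullbacks; models form a full subcategory of the functor category. -}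

module Defs where

open import Level using (Level; _⊔_; 0ℓ) renaming (suc to lsuc)
open import Data.Nat using (ℕ; _≟_)
open import Data.Product using (Σ; _×_; _,_; proj₁)
open import Relation.Nullary using (¬_; yes; no)
open import Relation.Binary.Structures using (IsEquivalence)
open import Relation.Binary.PropositionalEquality
  using (_≡_; refl; sym; trans; cong)

record Category (o ℓ e : Level) : Set (lsuc (o ⊔ ℓ ⊔ e)) where
  infixr 9 _∘_
  infix  4 _≈_
  field
    Obj   : Set o
    _⇒_   : Obj → Obj → Set ℓ
    _≈_   : ∀ {A B} → A ⇒ B → A ⇒ B → Set e
    id    : ∀ {A} → A ⇒ A
    _∘_   : ∀ {A B C} → B ⇒ C → A ⇒ B → A ⇒ C
    equiv : ∀ {A B} → IsEquivalence (_≈_ {A} {B})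
    assoc : ∀ {A B C D} {f : A ⇒ B} {g : B ⇒ C} {h : C ⇒ D} →
            (h ∘ g) ∘ f ≈ h ∘ (g ∘ f)
    identityˡ : ∀ {A B} {f : A ⇒ B} → id ∘ f ≈ f
    identityʳ : ∀ {A B} {f : A ⇒ B} → f ∘ id ≈ f
    ∘-resp-≈  : ∀ {A B C} {f h : B ⇒ C} {g i : A ⇒ B} →
                f ≈ h → g ≈ i → f ∘ g ≈ h ∘ i

record Functor {o ℓ e o′ ℓ′ e′ : Level}
               (C : Category o ℓ e) (D : Category o′ ℓ′ e′)
               : Set (o ⊔ ℓ ⊔ e ⊔ o′ ⊔ ℓ′ ⊔ e′) where
  private
    module C = Category C
    module D = Category D
  field
    F₀ : C.Obj → D.Obj
    F₁ : ∀ {A B} → A C.⇒ B → F₀ A D.⇒ F₀ B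
    identity     : ∀ {A} → F₁ (C.id {A}) D.≈ D.id
    homomorphism : ∀ {X Y Z} {f : X C.⇒ Y} {g : Y C.⇒ Z} →
                   F₁ (g C.∘ f) D.≈ F₁ g D.∘ F₁ f
    F-resp-≈     : ∀ {A B} {f g : A C.⇒ B} → f C.≈ g → F₁ f D.≈ F₁ g

idF : ∀ {o ℓ e} {C : Category o ℓ e} → Functor C C
idF {C = C} = record
  { F₀ = λ X → X ; F₁ = λ f → f
  ; identity = IsEquivalence.refl equiv
  ; homomorphism = IsEquivalence.refl equiv
  ; F-resp-≈ = λ p → p }
  where open Category C

_∘F_ : ∀ {o ℓ e o′ ℓ′ e′ o″ ℓ″ e″}
         {C : Category o ℓ e} {D : Category o′ ℓ′ e′} {E : Category o″ ℓ″ e″} →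
       Functor D E → Functor C D → Functor C E
_∘F_ {E = E} G F = record
  { F₀ = λ X → G.F₀ (F.F₀ X)
  ; F₁ = λ f → G.F₁ (F.F₁ f)
  ; identity = IsEquivalence.trans E.equiv (G.F-resp-≈ F.identity) G.identity
  ; homomorphism = IsEquivalence.trans E.equiv (G.F-resp-≈ F.homomorphism) G.homomorphism
  ; F-resp-≈ = λ p → G.F-resp-≈ (F.F-resp-≈ p) }
  where
    module G = Functor G
    module F = Functor F
    module E = Category E

record NaturalIsomorphism {o ℓ e o′ ℓ′ e′ : Level}
         {C : Category o ℓ e} {D : Category o′ ℓ′ e′}
         (F G : Functor C D) : Set (o ⊔ ℓ ⊔ e ⊔ o′ ⊔ ℓ′ ⊔ e′) where
  private
    module C = Category C
    module D = Category D
    module F = Functor F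
    module G = Functor G
  field
    η    : ∀ X → F.F₀ X D.⇒ G.F₀ X
    η⁻¹  : ∀ X → G.F₀ X D.⇒ F.F₀ X
    commute : ∀ {X Y} (f : X C.⇒ Y) → η Y D.∘ F.F₁ f D.≈ G.F₁ f D.∘ η X
    isoˡ : ∀ X → η⁻¹ X D.∘ η X D.≈ D.id
    isoʳ : ∀ X → η X D.∘ η⁻¹ X D.≈ D.id

record Equivalence {o ℓ e o′ ℓ′ e′ : Level}
         (C : Category o ℓ e) (D : Category o′ ℓ′ e′)
         : Set (o ⊔ ℓ ⊔ e ⊔ o′ ⊔ ℓ′ ⊔ e′) where
  field
    F : Functor C D
    G : Functor D C
    F∘G≅id : NaturalIsomorphism (F ∘F G) idF
    G∘F≅id : NaturalIsomorphism (G ∘F F) idF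

infixl 5 _▸_∶_
data Ctx (Ty : Set) : Set where
  ∅     : Ctx Ty
  _▸_∶_ : Ctx Ty → ℕ → Ty → Ctx Ty

data Sub (Tm : Set) : Set where
  ⟨⟩      : Sub Tm
  ⟨_,_↦_⟩ : Sub Tm → ℕ → Tm → Sub Tm

data Fresh {Ty : Set} (x : ℕ) : Ctx Ty → Set where
  fresh-∅ : Fresh x ∅
  fresh-▸ : ∀ {Γ y A} → Fresh x Γ → ¬ (x ≡ y) → Fresh x (Γ ▸ y ∶ A)

data _∶_∈_ {Ty : Set} (x : ℕ) (A : Ty) : Ctx Ty → Set where
  here  : ∀ {Γ} → x ∶ A ∈ (Γ ▸ x ∶ A)
  there : ∀ {Γ y B} → x ∶ A ∈ Γ → x ∶ A ∈ (Γ ▸ y ∶ B)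

lookupVar : {Tm : Set} → (ℕ → Tm) → ℕ → Sub Tm → Tm
lookupVar var x ⟨⟩ = var x
lookupVar var x ⟨ σ , y ↦ t ⟩ with x ≟ y
... | yes _ = t
... | no  _ = lookupVar var x σ

compSub : {Tm : Set} → (Tm → Sub Tm → Tm) → Sub Tm → Sub Tm → Sub Tm
compSub act ⟨⟩ δ = ⟨⟩
compSub act ⟨ σ , x ↦ t ⟩ δ = ⟨ compSub act σ δ , x ↦ act t δ ⟩

idSub : {Ty Tm : Set} → (ℕ → Tm) → Ctx Ty → Sub Tm
idSub var ∅ = ⟨⟩
idSub var (Γ ▸ x ∶ A) = ⟨ idSub var Γ , x ↦ var x ⟩

record TypeTheory : Set₁ where
  field
    Ty Tm  : Set
    var    : ℕ → Tm
    _[_]ty : Ty → Sub Tm → Ty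
    _[_]tm : Tm → Sub Tm → Tm
    _⊢     : Ctx Ty → Set
    _⊢s_∶_ : Ctx Ty → Sub Tm → Ctx Ty → Set
    SubEq : Ctx Ty → Sub Tm → Sub Tm → Ctx Ty → Set

module Syn (T : TypeTheory) where
  open TypeTheory T

  -- objects of Syn(T): derivable contexts
  -- (the derivation is irrelevant, so an object is just a derivable context)
  record Obj : Set where
    constructor ob
    field
      ctx : Ctx Ty
      .wf : ctx ⊢
  open Obj public

  record Hom (Δ Γ : Obj) : Set where
    constructor hom
    field
      sub : Sub Tm
      .wf : ctx Δ ⊢s sub ∶ ctx Γ
  open Hom public

  _≈_ : ∀ {Δ Γ} → Hom Δ Γ → Hom Δ Γ → Set
  _≈_ {Δ} {Γ} σ τ = SubEq (ctx Δ) (sub σ) (sub τ) (ctx Γ)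

  _∘s_ : Sub Tm → Sub Tm → Sub Tm
  σ ∘s δ = compSub _[_]tm σ δ

  ids : Ctx Ty → Sub Tm
  ids Γ = idSub var Γ

  IsSetPullback : {X B C D : Set} → (X → B) → (X → C) → (C → D) → (B → D) → Set
  IsSetPullback {X} top left f g =
    ∀ c b → f c ≡ g b →
      Σ X λ p → (left p ≡ c × top p ≡ b) ×
                (∀ p′ → left p′ ≡ c → top p′ ≡ b → p′ ≡ p)

  -- a model of Syn(T): a functor Syn(T) → Set preserving the terminal
  -- object and the pullback squares along display maps
  record Model : Set₁ where
    field
      F₀ : Obj → Set
      F₁ : ∀ {Δ Γ} → Hom Δ Γ → F₀ Δ → F₀ Γ
      F-resp : ∀ {Δ Γ} {σ τ : Hom Δ Γ} → σ ≈ τ → ∀ a → F₁ σ a ≡ F₁ τ a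
      F-id : ∀ {Γ} (i : Hom Γ Γ) → sub i ≡ ids (ctx Γ) → ∀ a → F₁ i a ≡ a
      F-comp : ∀ {Θ Δ Γ} (σ : Hom Δ Γ) (δ : Hom Θ Δ) (h : Hom Θ Γ) →
               sub h ≡ sub σ ∘s sub δ → ∀ a → F₁ h a ≡ F₁ σ (F₁ δ a)
      F-terminal : ∀ (E : Obj) → ctx E ≡ ∅ →
                   Σ (F₀ E) λ c → ∀ c′ → c′ ≡ c
      -- F sends the pullback square
      --    (Δ, y : A[f]) --⟨f, x ↦ y⟩--> (Γ, x : A)
      --        | p                           | p
      --        v                             v
      --        Δ  ------------ f --------->  Γ
      -- along display maps to a pullback square in Set
      F-pullback : ∀ {Δ Γ : Obj} (x y : ℕ) (A : Ty) (f : Hom Δ Γ)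
                   (ΓA : Obj) → ctx ΓA ≡ (ctx Γ ▸ x ∶ A) →
                   (ΔA : Obj) → ctx ΔA ≡ (ctx Δ ▸ y ∶ (A [ sub f ]ty)) →
                   (pΓ : Hom ΓA Γ) → sub pΓ ≡ ids (ctx Γ) →
                   (pΔ : Hom ΔA Δ) → sub pΔ ≡ ids (ctx Δ) →
                   (q : Hom ΔA ΓA) → sub q ≡ ⟨ sub f , x ↦ var y ⟩ →
                   IsSetPullback (F₁ q) (F₁ pΔ) (F₁ f) (F₁ pΓ)

  record ModelHom (M N : Model) : Set where
    private
      module M = Model M
      module N = Model N
    field
      η   : ∀ Γ → M.F₀ Γ → N.F₀ Γ
      nat : ∀ {Δ Γ} (σ : Hom Δ Γ) a → η Γ (M.F₁ σ a) ≡ N.F₁ σ (η Δ a)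
  open ModelHom public

  Mod : Category (lsuc 0ℓ) 0ℓ 0ℓ
  Mod = record
    { Obj = Model
    ; _⇒_ = ModelHom
    ; _≈_ = λ α β → ∀ Γ a → η α Γ a ≡ η β Γ a
    ; id = record { η = λ Γ a → a ; nat = λ σ a → refl }
    ; _∘_ = λ β α → record
        { η = λ Γ a → η β Γ (η α Γ a)
        ; nat = λ σ a → trans (cong (η β _) (nat α σ a)) (nat β σ (η α _ a)) }
    ; equiv = record
        { refl = λ Γ a → refl
        ; sym = λ p Γ a → sym (p Γ a)
        ; trans = λ p q Γ a → trans (p Γ a) (q Γ a) }
    ; assoc = λ Γ a → refl
    ; identityˡ = λ Γ a → refl
    ; identityʳ = λ Γ a → refl
    ; ∘-resp-≈ = λ {_} {_} {_} {f} {h} {g} {i} p q Γ a →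
        trans (cong (η f Γ) (q Γ a)) (p Γ (η i Γ a))
    }

module GlobSyntax where

  data Tm : Set where
    var : ℕ → Tm

  data Ty : Set where
    ⋆   : Ty
    Hom : Ty → Tm → Tm → Ty

  _[_]tm : Tm → Sub Tm → Tm
  var x [ σ ]tm = lookupVar var x σ

  _[_]ty : Ty → Sub Tm → Ty
  ⋆ [ σ ]ty = ⋆
  Hom A t u [ σ ]ty = Hom (A [ σ ]ty) (t [ σ ]tm) (u [ σ ]tm)

  infix 3 _⊢ _⊢ty_ _⊢_∶_ _⊢s_∶_
  mutual
    data _⊢ : Ctx Ty → Set where
      ∅-rule : ∅ ⊢
      ▸-rule : ∀ {Γ x A} → Γ ⊢ty A → Fresh x Γ → (Γ ▸ x ∶ A) ⊢

    data _⊢ty_ : Ctx Ty → Ty → Set where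
      ⋆-rule   : ∀ {Γ} → Γ ⊢ → Γ ⊢ty ⋆
      Hom-rule : ∀ {Γ A t u} → Γ ⊢ t ∶ A → Γ ⊢ u ∶ A → Γ ⊢ty Hom A t u

    data _⊢_∶_ : Ctx Ty → Tm → Ty → Set where
      var-rule : ∀ {Γ x A} → Γ ⊢ → x ∶ A ∈ Γ → Γ ⊢ var x ∶ A

  data _⊢s_∶_ : Ctx Ty → Sub Tm → Ctx Ty → Set where
    ⟨⟩-rule : ∀ {Δ} → Δ ⊢ → Δ ⊢s ⟨⟩ ∶ ∅
    ext-rule : ∀ {Δ Γ σ x A t} → Δ ⊢s σ ∶ Γ → (Γ ▸ x ∶ A) ⊢ →
               Δ ⊢ t ∶ (A [ σ ]ty) → Δ ⊢s ⟨ σ , x ↦ t ⟩ ∶ (Γ ▸ x ∶ A)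

Glob : TypeTheory
Glob = record
  { Ty = Ty ; Tm = Tm ; var = var
  ; _[_]ty = _[_]ty ; _[_]tm = _[_]tm
  ; _⊢ = _⊢ ; _⊢s_∶_ = _⊢s_∶_
  -- Glob has no definitional equality: morphisms are compared syntactically
  ; SubEq = λ Δ σ τ Γ → σ ≡ τ }
  where open GlobSyntax

module Glob₁Syntax where

  data Tm : Set where
    var  : ℕ → Tm
    unit : Tm

  data Ty : Set where
    𝟏   : Ty
    Hom : Ty → Tm → Tm → Ty

  _[_]tm : Tm → Sub Tm → Tm
  var x [ σ ]tm = lookupVar var x σ
  unit [ σ ]tm = unit

  _[_]ty : Ty → Sub Tm → Ty
  𝟏 [ σ ]ty = 𝟏
  Hom A t u [ σ ]ty = Hom (A [ σ ]ty) (t [ σ ]tm) (u [ σ ]tm)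

  ⋆ : Ty
  ⋆ = Hom 𝟏 unit unit

  infix 3 _⊢ _⊢ty_ _⊢_∶_ _⊢_≐ty_ _⊢_≐_∶_ _⊢s_∶_ _⊢s_≐_∶_
  mutual
    data _⊢ : Ctx Ty → Set where
      ∅-rule : ∅ ⊢
      ▸-rule : ∀ {Γ x A} → Γ ⊢ty A → Fresh x Γ → (Γ ▸ x ∶ A) ⊢

    data _⊢ty_ : Ctx Ty → Ty → Set where
      𝟏-rule   : ∀ {Γ} → Γ ⊢ → Γ ⊢ty 𝟏
      Hom-rule : ∀ {Γ A t u} → Γ ⊢ty A → Γ ⊢ t ∶ A → Γ ⊢ u ∶ A →
                 Γ ⊢ty Hom A t u

    data _⊢_∶_ : Ctx Ty → Tm → Ty → Set where
      var-rule  : ∀ {Γ x A} → Γ ⊢ → x ∶ A ∈ Γ → Γ ⊢ var x ∶ A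
      unit-rule : ∀ {Γ} → Γ ⊢ → Γ ⊢ unit ∶ 𝟏
      conv-rule : ∀ {Γ t A B} → Γ ⊢ t ∶ A → Γ ⊢ A ≐ty B → Γ ⊢ t ∶ B

    data _⊢_≐ty_ : Ctx Ty → Ty → Ty → Set where
      ≐ty-refl  : ∀ {Γ A} → Γ ⊢ty A → Γ ⊢ A ≐ty A
      ≐ty-sym   : ∀ {Γ A B} → Γ ⊢ A ≐ty B → Γ ⊢ B ≐ty A
      ≐ty-trans : ∀ {Γ A B C} → Γ ⊢ A ≐ty B → Γ ⊢ B ≐ty C → Γ ⊢ A ≐ty C
      ≐ty-Hom   : ∀ {Γ A A′ t t′ u u′} → Γ ⊢ A ≐ty A′ →
                  Γ ⊢ t ≐ t′ ∶ A → Γ ⊢ u ≐ u′ ∶ A →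
                  Γ ⊢ Hom A t u ≐ty Hom A′ t′ u′

    data _⊢_≐_∶_ : Ctx Ty → Tm → Tm → Ty → Set where
      ≡-refl  : ∀ {Γ t A} → Γ ⊢ t ∶ A → Γ ⊢ t ≐ t ∶ A
      ≡-sym   : ∀ {Γ t u A} → Γ ⊢ t ≐ u ∶ A → Γ ⊢ u ≐ t ∶ A
      ≡-trans : ∀ {Γ t u v A} → Γ ⊢ t ≐ u ∶ A → Γ ⊢ u ≐ v ∶ A →
                Γ ⊢ t ≐ v ∶ A
      ≡-conv  : ∀ {Γ t u A B} → Γ ⊢ t ≐ u ∶ A → Γ ⊢ A ≐ty B →
                Γ ⊢ t ≐ u ∶ B
      ≡-η𝟏    : ∀ {Γ t} → Γ ⊢ t ∶ 𝟏 → Γ ⊢ t ≐ unit ∶ 𝟏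

  data _⊢s_∶_ : Ctx Ty → Sub Tm → Ctx Ty → Set where
    ⟨⟩-rule : ∀ {Δ} → Δ ⊢ → Δ ⊢s ⟨⟩ ∶ ∅
    ext-rule : ∀ {Δ Γ σ x A t} → Δ ⊢s σ ∶ Γ → (Γ ▸ x ∶ A) ⊢ →
               Δ ⊢ t ∶ (A [ σ ]ty) → Δ ⊢s ⟨ σ , x ↦ t ⟩ ∶ (Γ ▸ x ∶ A)

  data _⊢s_≐_∶_ : Ctx Ty → Sub Tm → Sub Tm → Ctx Ty → Set where
    ⟨⟩-≡ : ∀ {Δ} → Δ ⊢ → Δ ⊢s ⟨⟩ ≐ ⟨⟩ ∶ ∅
    ext-≡ : ∀ {Δ Γ σ τ x A t u} → Δ ⊢s σ ≐ τ ∶ Γ → (Γ ▸ x ∶ A) ⊢ →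
            Δ ⊢ t ≐ u ∶ (A [ σ ]ty) →
            Δ ⊢s ⟨ σ , x ↦ t ⟩ ≐ ⟨ τ , x ↦ u ⟩ ∶ (Γ ▸ x ∶ A)

Glob₁ : TypeTheory
Glob₁ = record
  { Ty = Ty ; Tm = Tm ; var = var
  ; _[_]ty = _[_]ty ; _[_]tm = _[_]tm
  ; _⊢ = _⊢ ; _⊢s_∶_ = _⊢s_∶_ ; SubEq = _⊢s_≐_∶_ }
  where open Glob₁Syntax

ModGlob : Category (lsuc 0ℓ) 0ℓ 0ℓ
ModGlob = Syn.Mod Glob

ModGlob₁ : Category (lsuc 0ℓ) 0ℓ 0ℓ
ModGlob₁ = Syn.Mod Glob₁

-- Restriction along the inclusion ι : Syn(Glob) → Syn(Glob₁) and along the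
-- erasure Syn(Glob₁) → Syn(Glob), which drops the variables of type 𝟏 and
-- reads Hom 𝟏 t u as ⋆, are inverse up to isomorphism.  Erasure after ι is the
-- identity on contexts and substitutions.  Conversely, a context Γ of Glob₁
-- has substitutions π : Γ → ι(erase Γ), forgetting the variables of type 𝟏,
-- and ρ : ι(erase Γ) → Γ, instantiating them by (), with π ∘ ρ = id.  The
-- composite ρ ∘ π is not the identity, but N(ρ) ∘ N(π) = id in every model N
-- because N(π) is injective.  This goes by induction on Γ: N preserves the
-- terminal object and pullbacks along display maps, (x : 𝟏) is a retract of
-- the empty context, and extending Γ by a Hom type A is, after retyping the
-- new variable along A ≐ ι(erase A), a pullback of π_Γ along a display map.
module Submission where

open import Data.Bool using (Bool; true; false)
open import Data.Empty using (⊥-elim)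
open import Data.Nat using (ℕ; _≟_)
open import Data.Product using (_,_)
open import Function using (_∘_)
open import Function.Consequences.Propositional
  using (inverseʳ⇒injective; strictlyInverseʳ⇒inverseʳ)
open import Function.Definitions using (Injective)
open import Relation.Binary.Definitions using (DecidableEquality)
open import Relation.Binary.PropositionalEquality
  using (_≡_; _≢_; refl; sym; trans; cong; cong₂; subst; subst₂; module ≡-Reasoning)
open import Relation.Binary.PropositionalEquality.Properties
  using (subst-sym-subst; subst-subst-sym; subst-application′)
open import Relation.Nullary using (yes; no)
open import Relation.Nullary.Decidable using (recompute)

open import Defs

module G = GlobSyntax
module SG = Syn Glob
module S₁ = Syn Glob₁
open Glob₁Syntax
open S₁ using (ob; hom; ctx; sub; _∘s_)

-- Decidable equality of raw syntax, used to recompute equations proved from the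
-- irrelevant derivations carried by the morphisms of Syn(T)

≡-decSub : {Tm : Set} → DecidableEquality Tm → DecidableEquality (Sub Tm)
≡-decSub _ ⟨⟩ ⟨⟩ = yes refl
≡-decSub _ ⟨⟩ ⟨ _ , _ ↦ _ ⟩ = no λ ()
≡-decSub _ ⟨ _ , _ ↦ _ ⟩ ⟨⟩ = no λ ()
≡-decSub _≟ₜ_ ⟨ σ , x ↦ t ⟩ ⟨ τ , y ↦ u ⟩
  with ≡-decSub _≟ₜ_ σ τ | x ≟ y | t ≟ₜ u
... | yes refl | yes refl | yes refl = yes refl
... | no σ≢τ   | _        | _        = no λ { refl → σ≢τ refl }
... | yes _    | no x≢y   | _        = no λ { refl → x≢y refl }
... | yes _    | yes _    | no t≢u   = no λ { refl → t≢u refl }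

G-≡-decTm : DecidableEquality G.Tm
G-≡-decTm (G.var x) (G.var y) with x ≟ y
... | yes refl = yes refl
... | no x≢y   = no λ { refl → x≢y refl }

G-≡-decTy : DecidableEquality G.Ty
G-≡-decTy G.⋆ G.⋆ = yes refl
G-≡-decTy G.⋆ (G.Hom _ _ _) = no λ ()
G-≡-decTy (G.Hom _ _ _) G.⋆ = no λ ()
G-≡-decTy (G.Hom A t u) (G.Hom B t′ u′)
  with G-≡-decTy A B | G-≡-decTm t t′ | G-≡-decTm u u′
... | yes refl | yes refl | yes refl = yes refl
... | no A≢B   | _        | _        = no λ { refl → A≢B refl }
... | yes _    | no t≢t′  | _        = no λ { refl → t≢t′ refl }
... | yes _    | yes _    | no u≢u′  = no λ { refl → u≢u′ refl }

≡-decTm : DecidableEquality Tm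
≡-decTm (var x) (var y) with x ≟ y
... | yes refl = yes refl
... | no x≢y   = no λ { refl → x≢y refl }
≡-decTm (var _) unit = no λ ()
≡-decTm unit (var _) = no λ ()
≡-decTm unit unit = yes refl

module _ {Tm : Set} (v : ℕ → Tm) where

  lookupVar-idSub : ∀ {Ty : Set} z (Γ : Ctx Ty) → lookupVar v z (idSub v Γ) ≡ v z
  lookupVar-idSub z ∅ = refl
  lookupVar-idSub z (Γ ▸ x ∶ A) with z ≟ x
  ... | yes refl = refl
  ... | no _     = lookupVar-idSub z Γ

  lookupVar-here : ∀ y (σ : Sub Tm) t → lookupVar v y ⟨ σ , y ↦ t ⟩ ≡ t
  lookupVar-here y σ t with y ≟ y
  ... | yes _  = refl
  ... | no y≢y = ⊥-elim (y≢y refl)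

  lookupVar-there : ∀ {z y} (σ : Sub Tm) t → z ≢ y →
                    lookupVar v z ⟨ σ , y ↦ t ⟩ ≡ lookupVar v z σ
  lookupVar-there {z} {y} σ t z≢y with z ≟ y
  ... | yes z≡y = ⊥-elim (z≢y z≡y)
  ... | no _    = refl

⟨,↦⟩-cong : ∀ {Tm : Set} {σ σ′ : Sub Tm} {x} {t t′ : Tm} →
            σ ≡ σ′ → t ≡ t′ → ⟨ σ , x ↦ t ⟩ ≡ ⟨ σ′ , x ↦ t′ ⟩
⟨,↦⟩-cong refl refl = refl

fresh⇒≢ : ∀ {Ty : Set} {x y : ℕ} {A : Ty} {Γ : Ctx Ty} →
          Fresh y Γ → x ∶ A ∈ Γ → x ≢ y
fresh⇒≢ (fresh-▸ _ y≢x) here refl = y≢x refl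
fresh⇒≢ (fresh-▸ f _) (there m) = fresh⇒≢ f m

Hom-cong : ∀ {A A′ t t′ u u′} →
           A ≡ A′ → t ≡ t′ → u ≡ u′ → Hom A t u ≡ Hom A′ t′ u′
Hom-cong refl refl refl = refl

G-Hom-cong : ∀ {A A′ t t′ u u′} →
             A ≡ A′ → t ≡ t′ → u ≡ u′ → G.Hom A t u ≡ G.Hom A′ t′ u′
G-Hom-cong refl refl refl = refl

IsIdentity : Sub Tm → Set
IsIdentity τ = ∀ z → lookupVar var z τ ≡ var z

[]tm-identity : ∀ {τ} → IsIdentity τ → ∀ t → t [ τ ]tm ≡ t
[]tm-identity τ-id (var x) = τ-id x
[]tm-identity τ-id unit = refl

[]ty-identity : ∀ {τ} → IsIdentity τ → ∀ A → A [ τ ]ty ≡ A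
[]ty-identity τ-id 𝟏 = refl
[]ty-identity τ-id (Hom A t u) =
  Hom-cong ([]ty-identity τ-id A) ([]tm-identity τ-id t) ([]tm-identity τ-id u)

∘s-identityʳ : ∀ {τ} → IsIdentity τ → ∀ σ → σ ∘s τ ≡ σ
∘s-identityʳ τ-id ⟨⟩ = refl
∘s-identityʳ τ-id ⟨ σ , x ↦ t ⟩ =
  ⟨,↦⟩-cong (∘s-identityʳ τ-id σ) ([]tm-identity τ-id t)

idSub-isIdentity : ∀ (Γ : Ctx Ty) → IsIdentity (idSub var Γ)
idSub-isIdentity Γ z = lookupVar-idSub var z Γ

∘s-idSubʳ : ∀ Γ σ → σ ∘s idSub var Γ ≡ σ
∘s-idSubʳ Γ = ∘s-identityʳ (idSub-isIdentity Γ)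

isIdentity-ext : ∀ {τ} x → IsIdentity τ → IsIdentity ⟨ τ , x ↦ var x ⟩
isIdentity-ext x τ-id z with z ≟ x
... | yes refl = refl
... | no _     = τ-id z

⊢ty⇒⊢ : ∀ {Γ A} → Γ ⊢ty A → Γ ⊢
⊢ty⇒⊢ (𝟏-rule w) = w
⊢ty⇒⊢ (Hom-rule ⊢A _ _) = ⊢ty⇒⊢ ⊢A

⊢tm⇒⊢ : ∀ {Γ t A} → Γ ⊢ t ∶ A → Γ ⊢
⊢tm⇒⊢ (var-rule w _) = w
⊢tm⇒⊢ (unit-rule w) = w
⊢tm⇒⊢ (conv-rule ⊢t _) = ⊢tm⇒⊢ ⊢t

▸⊢⇒⊢ : ∀ {Γ x A} → (Γ ▸ x ∶ A) ⊢ → Γ ⊢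
▸⊢⇒⊢ (▸-rule ⊢A _) = ⊢ty⇒⊢ ⊢A

▸⊢⇒⊢ty : ∀ {Γ x A} → (Γ ▸ x ∶ A) ⊢ → Γ ⊢ty A
▸⊢⇒⊢ty (▸-rule ⊢A _) = ⊢A

module _ {Γ y B} (w : (Γ ▸ y ∶ B) ⊢) where
  mutual
    wkTy : ∀ {A} → Γ ⊢ty A → (Γ ▸ y ∶ B) ⊢ty A
    wkTy (𝟏-rule _) = 𝟏-rule w
    wkTy (Hom-rule ⊢A ⊢t ⊢u) = Hom-rule (wkTy ⊢A) (wkTm ⊢t) (wkTm ⊢u)

    wkTm : ∀ {t A} → Γ ⊢ t ∶ A → (Γ ▸ y ∶ B) ⊢ t ∶ A
    wkTm (var-rule _ m) = var-rule w (there m)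
    wkTm (unit-rule _) = unit-rule w
    wkTm (conv-rule ⊢t e) = conv-rule (wkTm ⊢t) (wk≐ty e)

    wk≐ty : ∀ {A A′} → Γ ⊢ A ≐ty A′ → (Γ ▸ y ∶ B) ⊢ A ≐ty A′
    wk≐ty (≐ty-refl ⊢A) = ≐ty-refl (wkTy ⊢A)
    wk≐ty (≐ty-sym e) = ≐ty-sym (wk≐ty e)
    wk≐ty (≐ty-trans e e′) = ≐ty-trans (wk≐ty e) (wk≐ty e′)
    wk≐ty (≐ty-Hom e e₁ e₂) = ≐ty-Hom (wk≐ty e) (wk≐ e₁) (wk≐ e₂)

    wk≐ : ∀ {t u A} → Γ ⊢ t ≐ u ∶ A → (Γ ▸ y ∶ B) ⊢ t ≐ u ∶ A
    wk≐ (≡-refl ⊢t) = ≡-refl (wkTm ⊢t)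
    wk≐ (≡-sym e) = ≡-sym (wk≐ e)
    wk≐ (≡-trans e e′) = ≡-trans (wk≐ e) (wk≐ e′)
    wk≐ (≡-conv e e′) = ≡-conv (wk≐ e) (wk≐ty e′)
    wk≐ (≡-η𝟏 ⊢t) = ≡-η𝟏 (wkTm ⊢t)

  wkSub : ∀ {Δ σ} → Γ ⊢s σ ∶ Δ → (Γ ▸ y ∶ B) ⊢s σ ∶ Δ
  wkSub (⟨⟩-rule _) = ⟨⟩-rule w
  wkSub (ext-rule ⊢σ w′ ⊢t) = ext-rule (wkSub ⊢σ) w′ (wkTm ⊢t)

∈⇒⊢ty : ∀ {Γ x A} → Γ ⊢ → x ∶ A ∈ Γ → Γ ⊢ty A
∈⇒⊢ty w@(▸-rule ⊢A _) here = wkTy w ⊢A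
∈⇒⊢ty w@(▸-rule ⊢A _) (there m) = wkTy w (∈⇒⊢ty (⊢ty⇒⊢ ⊢A) m)

⊢∶-[identity] : ∀ {Γ t A τ} → IsIdentity τ → Γ ⊢ t ∶ A → Γ ⊢ t ∶ A [ τ ]ty
⊢∶-[identity] {A = A} τ-id = subst (_ ⊢ _ ∶_) (sym ([]ty-identity τ-id A))

⊢idSub : ∀ {Γ} → Γ ⊢ → Γ ⊢s idSub var Γ ∶ Γ
⊢idSub ∅-rule = ⟨⟩-rule ∅-rule
⊢idSub {Γ ▸ x ∶ A} w@(▸-rule ⊢A _) =
  ext-rule (wkSub w (⊢idSub (⊢ty⇒⊢ ⊢A))) w
    (⊢∶-[identity] (idSub-isIdentity Γ) (var-rule w here))

⊢display : ∀ {Γ x A} → (Γ ▸ x ∶ A) ⊢ → (Γ ▸ x ∶ A) ⊢s idSub var Γ ∶ Γ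
⊢display w = wkSub w (⊢idSub (▸⊢⇒⊢ w))

-- Inversion for Glob₁: definitional equality is syntactic away from 𝟏

isOne : Ty → Bool
isOne 𝟏 = true
isOne (Hom _ _ _) = false

≐ty-isOne : ∀ {Γ A B} → Γ ⊢ A ≐ty B → isOne A ≡ isOne B
≐ty-isOne (≐ty-refl _) = refl
≐ty-isOne (≐ty-sym e) = sym (≐ty-isOne e)
≐ty-isOne (≐ty-trans e e′) = trans (≐ty-isOne e) (≐ty-isOne e′)
≐ty-isOne (≐ty-Hom _ _ _) = refl

≐⇒≡ : ∀ {Γ t u A} → isOne A ≡ false → Γ ⊢ t ≐ u ∶ A → t ≡ u
≐⇒≡ A≢𝟏 (≡-refl _) = refl
≐⇒≡ A≢𝟏 (≡-sym e) = sym (≐⇒≡ A≢𝟏 e)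
≐⇒≡ A≢𝟏 (≡-trans e e′) = trans (≐⇒≡ A≢𝟏 e) (≐⇒≡ A≢𝟏 e′)
≐⇒≡ B≢𝟏 (≡-conv e A≐B) = ≐⇒≡ (trans (≐ty-isOne A≐B) B≢𝟏) e
≐⇒≡ () (≡-η𝟏 _)

data TmView (Γ : Ctx Ty) (A : Ty) : Tm → Set where
  unitView : Γ ⊢ 𝟏 ≐ty A → TmView Γ A unit
  varView  : ∀ {x B} → x ∶ B ∈ Γ → Γ ⊢ B ≐ty A → TmView Γ A (var x)

tmView : ∀ {Γ t A} → Γ ⊢ t ∶ A → TmView Γ A t
tmView (var-rule w m) = varView m (≐ty-refl (∈⇒⊢ty w m))
tmView (unit-rule w) = unitView (≐ty-refl (𝟏-rule w))
tmView (conv-rule ⊢t A≐B) with tmView ⊢t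
... | unitView e = unitView (≐ty-trans e A≐B)
... | varView m e = varView m (≐ty-trans e A≐B)

data HomVar (Γ : Ctx Ty) (A : Ty) : Tm → Set where
  homVar : ∀ {x B t u} → x ∶ Hom B t u ∈ Γ → Γ ⊢ Hom B t u ≐ty A →
           HomVar Γ A (var x)

⊢∶Hom⇒HomVar : ∀ {Γ t B a b} → Γ ⊢ t ∶ Hom B a b → HomVar Γ (Hom B a b) t
⊢∶Hom⇒HomVar ⊢t with tmView ⊢t
... | unitView e with ≐ty-isOne e
...   | ()
⊢∶Hom⇒HomVar ⊢t | varView {B = 𝟏} m e with ≐ty-isOne e
...   | ()
⊢∶Hom⇒HomVar ⊢t | varView {B = Hom _ _ _} m e = homVar m e

data OneTm (Γ : Ctx Ty) : Tm → Set where
  unitTm : OneTm Γ unit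
  varTm  : ∀ {x} → x ∶ 𝟏 ∈ Γ → OneTm Γ (var x)

⊢∶𝟏⇒OneTm : ∀ {Γ t} → Γ ⊢ t ∶ 𝟏 → OneTm Γ t
⊢∶𝟏⇒OneTm ⊢t with tmView ⊢t
... | unitView _ = unitTm
... | varView {B = 𝟏} m _ = varTm m
... | varView {B = Hom _ _ _} m e with ≐ty-isOne e
...   | ()

ιTm : G.Tm → Tm
ιTm (G.var x) = var x

ιTy : G.Ty → Ty
ιTy G.⋆ = ⋆
ιTy (G.Hom A t u) = Hom (ιTy A) (ιTm t) (ιTm u)

ιCtx : Ctx G.Ty → Ctx Ty
ιCtx ∅ = ∅
ιCtx (Γ ▸ x ∶ A) = ιCtx Γ ▸ x ∶ ιTy A

ιSub : Sub G.Tm → Sub Tm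
ιSub ⟨⟩ = ⟨⟩
ιSub ⟨ σ , x ↦ t ⟩ = ⟨ ιSub σ , x ↦ ιTm t ⟩

ιTm-lookupVar : ∀ x σ → ιTm (lookupVar G.var x σ) ≡ lookupVar var x (ιSub σ)
ιTm-lookupVar x ⟨⟩ = refl
ιTm-lookupVar x ⟨ σ , y ↦ t ⟩ with x ≟ y
... | yes _ = refl
... | no _  = ιTm-lookupVar x σ

ιTm-[] : ∀ t σ → ιTm (t G.[ σ ]tm) ≡ ιTm t [ ιSub σ ]tm
ιTm-[] (G.var x) σ = ιTm-lookupVar x σ

ιTy-[] : ∀ A σ → ιTy (A G.[ σ ]ty) ≡ ιTy A [ ιSub σ ]ty
ιTy-[] G.⋆ σ = refl
ιTy-[] (G.Hom A t u) σ = Hom-cong (ιTy-[] A σ) (ιTm-[] t σ) (ιTm-[] u σ)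

ιSub-∘s : ∀ σ δ → ιSub (σ SG.∘s δ) ≡ ιSub σ ∘s ιSub δ
ιSub-∘s ⟨⟩ δ = refl
ιSub-∘s ⟨ σ , x ↦ t ⟩ δ = ⟨,↦⟩-cong (ιSub-∘s σ δ) (ιTm-[] t δ)

ιSub-idSub : ∀ Γ → ιSub (idSub G.var Γ) ≡ idSub var (ιCtx Γ)
ιSub-idSub ∅ = refl
ιSub-idSub (Γ ▸ x ∶ A) = ⟨,↦⟩-cong (ιSub-idSub Γ) refl

ι-∈ : ∀ {x A Γ} → x ∶ A ∈ Γ → x ∶ ιTy A ∈ ιCtx Γ
ι-∈ here = here
ι-∈ (there m) = there (ι-∈ m)

ι-Fresh : ∀ {x Γ} → Fresh x Γ → Fresh x (ιCtx Γ)
ι-Fresh fresh-∅ = fresh-∅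
ι-Fresh (fresh-▸ f x≢y) = fresh-▸ (ι-Fresh f) x≢y

G-⊢ty⇒⊢ : ∀ {Γ A} → Γ G.⊢ty A → Γ G.⊢
G-⊢ty⇒⊢ (G.⋆-rule w) = w
G-⊢ty⇒⊢ (G.Hom-rule (G.var-rule w _) _) = w

⊢ιTm : ∀ {Γ t A} → ιCtx Γ ⊢ → Γ G.⊢ t ∶ A → ιCtx Γ ⊢ ιTm t ∶ ιTy A
⊢ιTm w (G.var-rule _ m) = var-rule w (ι-∈ m)

⊢ιTy : ∀ {Γ A} → ιCtx Γ ⊢ → Γ G.⊢ty A → ιCtx Γ ⊢ty ιTy A
⊢ιTy w (G.⋆-rule _) = Hom-rule (𝟏-rule w) (unit-rule w) (unit-rule w)
⊢ιTy w (G.Hom-rule ⊢t@(G.var-rule _ m) ⊢u) =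
  Hom-rule (∈⇒⊢ty w (ι-∈ m)) (⊢ιTm w ⊢t) (⊢ιTm w ⊢u)

⊢ιCtx : ∀ {Γ} → Γ G.⊢ → ιCtx Γ ⊢
⊢ιCtx G.∅-rule = ∅-rule
⊢ιCtx (G.▸-rule ⊢A f) = ▸-rule (⊢ιTy (⊢ιCtx (G-⊢ty⇒⊢ ⊢A)) ⊢A) (ι-Fresh f)

⊢ιSub : ∀ {Δ σ Γ} → Δ G.⊢s σ ∶ Γ → ιCtx Δ ⊢s ιSub σ ∶ ιCtx Γ
⊢ιSub (G.⟨⟩-rule w) = ⟨⟩-rule (⊢ιCtx w)
⊢ιSub (G.ext-rule {σ = σ} {A = A} ⊢σ w ⊢t@(G.var-rule wΔ _)) =
  ext-rule (⊢ιSub ⊢σ) (⊢ιCtx w) (subst (_ ⊢ _ ∶_) (ιTy-[] A σ) (⊢ιTm (⊢ιCtx wΔ) ⊢t))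

-- The image of () is junk: () only stands at type 𝟏, which is erased.
eraseTm : Tm → G.Tm
eraseTm (var x) = G.var x
eraseTm unit = G.var 0

eraseTy : Ty → G.Ty
eraseTy 𝟏 = G.⋆
eraseTy (Hom 𝟏 _ _) = G.⋆
eraseTy (Hom A@(Hom _ _ _) t u) = G.Hom (eraseTy A) (eraseTm t) (eraseTm u)

eraseCtx : Ctx Ty → Ctx G.Ty
eraseCtx ∅ = ∅
eraseCtx (Γ ▸ x ∶ 𝟏) = eraseCtx Γ
eraseCtx (Γ ▸ x ∶ A@(Hom _ _ _)) = eraseCtx Γ ▸ x ∶ eraseTy A

eraseSub : Ctx Ty → Sub Tm → Sub G.Tm
eraseSub ∅ σ = ⟨⟩
eraseSub (Γ ▸ x ∶ A) ⟨⟩ = ⟨⟩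
eraseSub (Γ ▸ x ∶ 𝟏) ⟨ σ , y ↦ t ⟩ = eraseSub Γ σ
eraseSub (Γ ▸ x ∶ Hom _ _ _) ⟨ σ , y ↦ t ⟩ = ⟨ eraseSub Γ σ , x ↦ eraseTm t ⟩

eraseSub-idSub : ∀ Γ → eraseSub Γ (idSub var Γ) ≡ idSub G.var (eraseCtx Γ)
eraseSub-idSub ∅ = refl
eraseSub-idSub (Γ ▸ x ∶ 𝟏) = eraseSub-idSub Γ
eraseSub-idSub (Γ ▸ x ∶ Hom _ _ _) = ⟨,↦⟩-cong (eraseSub-idSub Γ) refl

eraseTy-ιTy : ∀ A → eraseTy (ιTy A) ≡ A
eraseTy-ιTy G.⋆ = refl
eraseTy-ιTy (G.Hom G.⋆ (G.var _) (G.var _)) = refl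
eraseTy-ιTy (G.Hom A@(G.Hom _ _ _) (G.var _) (G.var _)) =
  G-Hom-cong (eraseTy-ιTy A) refl refl

eraseCtx-ιCtx : ∀ Γ → eraseCtx (ιCtx Γ) ≡ Γ
eraseCtx-ιCtx ∅ = refl
eraseCtx-ιCtx (Γ ▸ x ∶ G.⋆) = cong (_▸ x ∶ G.⋆) (eraseCtx-ιCtx Γ)
eraseCtx-ιCtx (Γ ▸ x ∶ A@(G.Hom _ _ _)) =
  cong₂ (_▸ x ∶_) (eraseCtx-ιCtx Γ) (eraseTy-ιTy A)

eraseSub-ιSub : ∀ {Δ σ Γ} → Δ G.⊢s σ ∶ Γ → eraseSub (ιCtx Γ) (ιSub σ) ≡ σ
eraseSub-ιSub (G.⟨⟩-rule _) = refl
eraseSub-ιSub (G.ext-rule {A = G.⋆} {t = G.var _} ⊢σ _ _) =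
  ⟨,↦⟩-cong (eraseSub-ιSub ⊢σ) refl
eraseSub-ιSub (G.ext-rule {A = G.Hom _ _ _} {t = G.var _} ⊢σ _ _) =
  ⟨,↦⟩-cong (eraseSub-ιSub ⊢σ) refl

erase-∈ : ∀ {x B a b Γ} →
          x ∶ Hom B a b ∈ Γ → x ∶ eraseTy (Hom B a b) ∈ eraseCtx Γ
erase-∈ here = here
erase-∈ (there {B = 𝟏} m) = erase-∈ m
erase-∈ (there {B = Hom _ _ _} m) = there (erase-∈ m)

erase-Fresh : ∀ {x Γ} → Fresh x Γ → Fresh x (eraseCtx Γ)
erase-Fresh fresh-∅ = fresh-∅
erase-Fresh (fresh-▸ {A = 𝟏} f _) = erase-Fresh f
erase-Fresh (fresh-▸ {A = Hom _ _ _} f x≢y) = fresh-▸ (erase-Fresh f) x≢y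

eraseTy-≐ty : ∀ {Γ A B} → Γ ⊢ A ≐ty B → eraseTy A ≡ eraseTy B
eraseTy-≐ty (≐ty-refl _) = refl
eraseTy-≐ty (≐ty-sym e) = sym (eraseTy-≐ty e)
eraseTy-≐ty (≐ty-trans e e′) = trans (eraseTy-≐ty e) (eraseTy-≐ty e′)
eraseTy-≐ty (≐ty-Hom {A = 𝟏} {A′ = 𝟏} _ _ _) = refl
eraseTy-≐ty (≐ty-Hom {A = 𝟏} {A′ = Hom _ _ _} e _ _) with ≐ty-isOne e
... | ()
eraseTy-≐ty (≐ty-Hom {A = Hom _ _ _} {A′ = 𝟏} e _ _) with ≐ty-isOne e
... | ()
eraseTy-≐ty (≐ty-Hom {A = Hom _ _ _} {A′ = Hom _ _ _} e t≐t′ u≐u′) =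
  G-Hom-cong (eraseTy-≐ty e) (cong eraseTm (≐⇒≡ refl t≐t′))
                             (cong eraseTm (≐⇒≡ refl u≐u′))

⊢eraseTm : ∀ {Γ t B a b} → eraseCtx Γ G.⊢ → Γ ⊢ t ∶ Hom B a b →
           eraseCtx Γ G.⊢ eraseTm t ∶ eraseTy (Hom B a b)
⊢eraseTm w ⊢t with ⊢∶Hom⇒HomVar ⊢t
... | homVar m e = subst (_ G.⊢ _ ∶_) (eraseTy-≐ty e) (G.var-rule w (erase-∈ m))

⊢eraseTy : ∀ {Γ A} → eraseCtx Γ G.⊢ → Γ ⊢ty A → eraseCtx Γ G.⊢ty eraseTy A
⊢eraseTy w (𝟏-rule _) = G.⋆-rule w
⊢eraseTy w (Hom-rule {A = 𝟏} _ _ _) = G.⋆-rule w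
⊢eraseTy w (Hom-rule {A = Hom _ _ _} _ ⊢t ⊢u) =
  G.Hom-rule (⊢eraseTm w ⊢t) (⊢eraseTm w ⊢u)

⊢eraseCtx : ∀ {Γ} → Γ ⊢ → eraseCtx Γ G.⊢
⊢eraseCtx ∅-rule = G.∅-rule
⊢eraseCtx (▸-rule {A = 𝟏} ⊢A _) = ⊢eraseCtx (⊢ty⇒⊢ ⊢A)
⊢eraseCtx (▸-rule {A = Hom _ _ _} ⊢A f) =
  G.▸-rule (⊢eraseTy (⊢eraseCtx (⊢ty⇒⊢ ⊢A)) ⊢A) (erase-Fresh f)

eraseTm-lookupVar : ∀ {Δ Γ σ x B a b} → Δ ⊢s σ ∶ Γ → x ∶ Hom B a b ∈ Γ →
                    eraseTm (lookupVar var x σ) ≡ lookupVar G.var x (eraseSub Γ σ)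
eraseTm-lookupVar (ext-rule {Γ = Γ} {σ = σ} {x = y} {t = t} _ _ _) here =
  trans (cong eraseTm (lookupVar-here var y σ t))
        (sym (lookupVar-here G.var y (eraseSub Γ σ) (eraseTm t)))
eraseTm-lookupVar {x = x}
  (ext-rule {Γ = Γ} {σ = σ} {x = y} {A = A} {t = t} ⊢σ (▸-rule _ f) _) (there m) =
  trans (cong eraseTm (lookupVar-there var σ t x≢y)) (erased A)
  where
    x≢y = fresh⇒≢ f m
    erased : ∀ A′ → eraseTm (lookupVar var x σ) ≡
                    lookupVar G.var x (eraseSub (Γ ▸ y ∶ A′) ⟨ σ , y ↦ t ⟩)
    erased 𝟏 = eraseTm-lookupVar ⊢σ m
    erased (Hom _ _ _) =
      trans (eraseTm-lookupVar ⊢σ m)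
            (sym (lookupVar-there G.var (eraseSub Γ σ) (eraseTm t) x≢y))

eraseTm-[] : ∀ {Δ Γ σ t B a b} → Γ ⊢ t ∶ Hom B a b → Δ ⊢s σ ∶ Γ →
             eraseTm (t [ σ ]tm) ≡ eraseTm t G.[ eraseSub Γ σ ]tm
eraseTm-[] ⊢t ⊢σ with ⊢∶Hom⇒HomVar ⊢t
... | homVar m _ = eraseTm-lookupVar ⊢σ m

eraseTy-[] : ∀ {Δ Γ σ A} → Γ ⊢ty A → Δ ⊢s σ ∶ Γ →
             eraseTy (A [ σ ]ty) ≡ eraseTy A G.[ eraseSub Γ σ ]ty
eraseTy-[] (𝟏-rule _) _ = refl
eraseTy-[] (Hom-rule {A = 𝟏} _ _ _) _ = refl
eraseTy-[] (Hom-rule {A = Hom _ _ _} ⊢A ⊢t ⊢u) ⊢σ =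
  G-Hom-cong (eraseTy-[] ⊢A ⊢σ) (eraseTm-[] ⊢t ⊢σ) (eraseTm-[] ⊢u ⊢σ)

⊢eraseSub : ∀ {Δ Γ σ} → eraseCtx Δ G.⊢ → Δ ⊢s σ ∶ Γ →
            eraseCtx Δ G.⊢s eraseSub Γ σ ∶ eraseCtx Γ
⊢eraseSub w (⟨⟩-rule _) = G.⟨⟩-rule w
⊢eraseSub w (ext-rule {A = 𝟏} ⊢σ _ _) = ⊢eraseSub w ⊢σ
⊢eraseSub w (ext-rule {A = Hom _ _ _} ⊢σ wΓA@(▸-rule ⊢A _) ⊢t) =
  G.ext-rule (⊢eraseSub w ⊢σ) (⊢eraseCtx wΓA)
    (subst (_ G.⊢ _ ∶_) (eraseTy-[] ⊢A ⊢σ) (⊢eraseTm w ⊢t))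

eraseSub-∘s : ∀ {Θ Δ Γ σ δ} → Θ ⊢s δ ∶ Δ → Δ ⊢s σ ∶ Γ →
              eraseSub Γ (σ ∘s δ) ≡ eraseSub Γ σ SG.∘s eraseSub Δ δ
eraseSub-∘s ⊢δ (⟨⟩-rule _) = refl
eraseSub-∘s ⊢δ (ext-rule {A = 𝟏} ⊢σ _ _) = eraseSub-∘s ⊢δ ⊢σ
eraseSub-∘s ⊢δ (ext-rule {A = Hom _ _ _} ⊢σ _ ⊢t) =
  ⟨,↦⟩-cong (eraseSub-∘s ⊢δ ⊢σ) (eraseTm-[] ⊢t ⊢δ)

eraseSub-≐ : ∀ {Δ Γ σ τ} → Δ ⊢s σ ≐ τ ∶ Γ → eraseSub Γ σ ≡ eraseSub Γ τ
eraseSub-≐ (⟨⟩-≡ _) = refl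
eraseSub-≐ (ext-≡ {A = 𝟏} σ≐τ _ _) = eraseSub-≐ σ≐τ
eraseSub-≐ (ext-≡ {A = Hom _ _ _} σ≐τ _ t≐u) =
  ⟨,↦⟩-cong (eraseSub-≐ σ≐τ) (cong eraseTm (≐⇒≡ refl t≐u))

ιerase : Ctx Ty → Ctx Ty
ιerase Γ = ιCtx (eraseCtx Γ)

ιeraseTy : Ty → Ty
ιeraseTy A = ιTy (eraseTy A)

π : Ctx Ty → Sub Tm
π Γ = idSub var (ιerase Γ)

ρ-entry : ℕ → Ty → Tm
ρ-entry x 𝟏 = unit
ρ-entry x (Hom _ _ _) = var x

ρ : Ctx Ty → Sub Tm
ρ ∅ = ⟨⟩
ρ (Γ ▸ x ∶ A) = ⟨ ρ Γ , x ↦ ρ-entry x A ⟩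

⊢ιerase : ∀ {Γ} → Γ ⊢ → ιerase Γ ⊢
⊢ιerase w = ⊢ιCtx (⊢eraseCtx w)

≐ty-ιeraseTy : ∀ {Γ B t u} → Γ ⊢ty Hom B t u →
               Γ ⊢ Hom B t u ≐ty ιeraseTy (Hom B t u)
≐ty-ιeraseTy {B = 𝟏} (Hom-rule ⊢𝟏 ⊢t ⊢u) = ≐ty-Hom (≐ty-refl ⊢𝟏) (≡-η𝟏 ⊢t) (≡-η𝟏 ⊢u)
≐ty-ιeraseTy {B = Hom _ _ _} (Hom-rule ⊢A ⊢t ⊢u)
  with ⊢∶Hom⇒HomVar ⊢t | ⊢∶Hom⇒HomVar ⊢u
... | homVar _ _ | homVar _ _ = ≐ty-Hom (≐ty-ιeraseTy ⊢A) (≡-refl ⊢t) (≡-refl ⊢u)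

⊢ιeraseTy : ∀ {Γ B t u} → Γ ⊢ty Hom B t u → Γ ⊢ty ιeraseTy (Hom B t u)
⊢ιeraseTy {B = 𝟏} (Hom-rule ⊢𝟏 _ _) = Hom-rule ⊢𝟏 (unit-rule w) (unit-rule w)
  where w = ⊢ty⇒⊢ ⊢𝟏
⊢ιeraseTy {B = Hom _ _ _} (Hom-rule ⊢A ⊢t ⊢u)
  with ⊢∶Hom⇒HomVar ⊢t | ⊢∶Hom⇒HomVar ⊢u
... | homVar _ _ | homVar _ _ =
  Hom-rule (⊢ιeraseTy ⊢A) (conv-rule ⊢t (≐ty-ιeraseTy ⊢A))
                          (conv-rule ⊢u (≐ty-ιeraseTy ⊢A))

lookupVar-ρ : ∀ {Γ x A} → Γ ⊢ → x ∶ A ∈ Γ → lookupVar var x (ρ Γ) ≡ ρ-entry x A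
lookupVar-ρ {Γ ▸ y ∶ B} _ here = lookupVar-here var y (ρ _) (ρ-entry y B)
lookupVar-ρ {Γ ▸ y ∶ B} (▸-rule ⊢B f) (there m) =
  trans (lookupVar-there var (ρ Γ) (ρ-entry y B) (fresh⇒≢ f m))
        (lookupVar-ρ (⊢ty⇒⊢ ⊢B) m)

[ρ]-𝟏 : ∀ {Γ t} → Γ ⊢ → Γ ⊢ t ∶ 𝟏 → t [ ρ Γ ]tm ≡ unit
[ρ]-𝟏 w ⊢t with ⊢∶𝟏⇒OneTm ⊢t
... | unitTm = refl
... | varTm m = lookupVar-ρ w m

ιeraseTy-≐ty-[ρ] : ∀ {Γ B t u} → Γ ⊢ → Γ ⊢ty Hom B t u →
                  ιerase Γ ⊢ ιeraseTy (Hom B t u) ≐ty Hom B t u [ ρ Γ ]ty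
ιeraseTy-≐ty-[ρ] {Γ} {𝟏} w (Hom-rule _ ⊢t ⊢u) =
  subst₂ (λ t′ u′ → ιerase Γ ⊢ ⋆ ≐ty Hom 𝟏 t′ u′) (sym ([ρ]-𝟏 w ⊢t)) (sym ([ρ]-𝟏 w ⊢u))
    (≐ty-refl (Hom-rule (𝟏-rule w′) (unit-rule w′) (unit-rule w′)))
  where w′ = ⊢ιerase w
ιeraseTy-≐ty-[ρ] {Γ} {A@(Hom _ _ _)} w (Hom-rule ⊢A ⊢t ⊢u)
  with ⊢∶Hom⇒HomVar ⊢t | ⊢∶Hom⇒HomVar ⊢u
... | homVar m e | homVar m′ e′ =
  subst₂ (λ t′ u′ → ιerase Γ ⊢ _ ≐ty Hom (A [ ρ Γ ]ty) t′ u′)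
    (sym (lookupVar-ρ w m)) (sym (lookupVar-ρ w m′))
    (≐ty-Hom (ιeraseTy-≐ty-[ρ] w ⊢A) (≡-refl (⊢var m e)) (≡-refl (⊢var m′ e′)))
  where
    ⊢var : ∀ {y C c d} → y ∶ Hom C c d ∈ Γ → Γ ⊢ Hom C c d ≐ty A →
           ιerase Γ ⊢ var y ∶ ιeraseTy A
    ⊢var n e₀ = subst (_ ⊢ _ ∶_) (cong ιTy (eraseTy-≐ty e₀))
                  (var-rule (⊢ιerase w) (ι-∈ (erase-∈ n)))

⊢ρ : ∀ {Γ} → Γ ⊢ → ιerase Γ ⊢s ρ Γ ∶ Γ
⊢ρ ∅-rule = ⟨⟩-rule ∅-rule
⊢ρ w@(▸-rule {A = 𝟏} ⊢𝟏 _) =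
  ext-rule (⊢ρ (⊢ty⇒⊢ ⊢𝟏)) w (unit-rule (⊢ιerase (⊢ty⇒⊢ ⊢𝟏)))
⊢ρ w@(▸-rule {A = Hom _ _ _} ⊢A _) =
  ext-rule (wkSub w′ (⊢ρ wΓ)) w
    (conv-rule (var-rule w′ here) (wk≐ty w′ (ιeraseTy-≐ty-[ρ] wΓ ⊢A)))
  where
    wΓ = ⊢ty⇒⊢ ⊢A
    w′ = ⊢ιerase w

⊢π : ∀ {Γ} → Γ ⊢ → Γ ⊢s π Γ ∶ ιerase Γ
⊢π ∅-rule = ⟨⟩-rule ∅-rule
⊢π w@(▸-rule {A = 𝟏} ⊢𝟏 _) = wkSub w (⊢π (⊢ty⇒⊢ ⊢𝟏))
⊢π {Γ ▸ x ∶ _} w@(▸-rule {A = Hom _ _ _} ⊢A _) =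
  ext-rule (wkSub w (⊢π (⊢ty⇒⊢ ⊢A))) (⊢ιerase w)
    (⊢∶-[identity] (idSub-isIdentity (ιerase Γ))
      (conv-rule (var-rule w here) (wk≐ty w (≐ty-ιeraseTy ⊢A))))

⊢ιeraseSub : ∀ {Δ Γ σ} → Δ ⊢s σ ∶ Γ → Δ ⊢s ιSub (eraseSub Γ σ) ∶ ιerase Γ
⊢ιeraseSub (⟨⟩-rule w) = ⟨⟩-rule w
⊢ιeraseSub (ext-rule {A = 𝟏} ⊢σ _ _) = ⊢ιeraseSub ⊢σ
⊢ιeraseSub (ext-rule {Γ = Γ} {σ = σ} {A = A@(Hom _ _ _)} ⊢σ wΓA@(▸-rule ⊢A _) ⊢t)
  with ⊢∶Hom⇒HomVar ⊢t
... | homVar {B = C} {c} {d} m e =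
  ext-rule (⊢ιeraseSub ⊢σ) (⊢ιerase wΓA)
    (subst (_ ⊢ _ ∶_) ιerase-[]
      (conv-rule (var-rule wΔ m) (≐ty-ιeraseTy (∈⇒⊢ty wΔ m))))
  where
    wΔ = ⊢tm⇒⊢ ⊢t
    ιerase-[] : ιeraseTy (Hom C c d) ≡ ιeraseTy A [ ιSub (eraseSub Γ σ) ]ty
    ιerase-[] = trans (cong ιTy (trans (eraseTy-≐ty e) (eraseTy-[] ⊢A ⊢σ)))
                      (ιTy-[] (eraseTy A) (eraseSub Γ σ))

π∘s-fresh : ∀ {Γ y τ t} → Fresh y Γ → π Γ ∘s ⟨ τ , y ↦ t ⟩ ≡ π Γ ∘s τ
π∘s-fresh fresh-∅ = refl
π∘s-fresh (fresh-▸ {A = 𝟏} f _) = π∘s-fresh f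
π∘s-fresh {τ = τ} {t} (fresh-▸ {A = Hom _ _ _} f y≢x) =
  ⟨,↦⟩-cong (π∘s-fresh f) (lookupVar-there var τ t (λ x≡y → y≢x (sym x≡y)))

π∘ρ≡π : ∀ {Γ} → Γ ⊢ → π Γ ∘s ρ Γ ≡ π Γ
π∘ρ≡π ∅-rule = refl
π∘ρ≡π (▸-rule {A = 𝟏} ⊢𝟏 f) = trans (π∘s-fresh f) (π∘ρ≡π (⊢ty⇒⊢ ⊢𝟏))
π∘ρ≡π {Γ ▸ x ∶ _} (▸-rule {A = Hom _ _ _} ⊢A f) =
  ⟨,↦⟩-cong (trans (π∘s-fresh f) (π∘ρ≡π (⊢ty⇒⊢ ⊢A))) (lookupVar-here var x (ρ Γ) (var x))

ιSub-eraseSub : ∀ {Δ Γ σ} → Δ ⊢s σ ∶ Γ → ιSub (eraseSub Γ σ) ≡ π Γ ∘s σ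
ιSub-eraseSub (⟨⟩-rule _) = refl
ιSub-eraseSub (ext-rule {A = 𝟏} ⊢σ (▸-rule _ f) _) =
  trans (ιSub-eraseSub ⊢σ) (sym (π∘s-fresh f))
ιSub-eraseSub (ext-rule {σ = σ} {x = x} {A = Hom _ _ _} ⊢σ (▸-rule _ f) ⊢t)
  with ⊢∶Hom⇒HomVar ⊢t
... | homVar {x = z} _ _ =
  ⟨,↦⟩-cong (trans (ιSub-eraseSub ⊢σ) (sym (π∘s-fresh f)))
            (sym (lookupVar-here var x σ (var z)))

identity-isSetPullback :
  ∀ {C D : Set} {top : C → D} {left : C → C} {f : C → D} {g : D → D} →
  (∀ c → left c ≡ c) → (∀ d → g d ≡ d) → (∀ c → top c ≡ f c) →
  S₁.IsSetPullback top left f g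
identity-isSetPullback left-id g-id top≗f c b fc≡gb =
  c , (left-id c , trans (top≗f c) (trans fc≡gb (g-id b))) ,
  λ p leftp≡c _ → trans (sym (left-id p)) leftp≡c

isSetPullback-jointlyInjective :
  ∀ {X B C D : Set} {top : X → B} {left : X → C} {f : C → D} {g : B → D} →
  S₁.IsSetPullback top left f g → (∀ p → f (left p) ≡ g (top p)) →
  ∀ {p p′} → left p ≡ left p′ → top p ≡ top p′ → p ≡ p′
isSetPullback-jointlyInjective pb commutes {p} {p′} left≡ top≡
  with pb _ _ (commutes p′)
... | _ , _ , unique = trans (unique p left≡ top≡) (sym (unique p′ refl refl))

module _ {T : TypeTheory} where
  private module S = Syn T

  Hom-≡ : ∀ {Δ Γ} {f g : S.Hom Δ Γ} → S.sub f ≡ S.sub g → f ≡ g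
  Hom-≡ {f = S.hom _ _} {S.hom _ _} refl = refl

  Obj-≡ : ∀ {X Y : S.Obj} → S.ctx X ≡ S.ctx Y → X ≡ Y
  Obj-≡ {S.ob _ _} {S.ob _ _} refl = refl

eraseObj : S₁.Obj → SG.Obj
eraseObj (ob Γ w) = SG.ob (eraseCtx Γ) (⊢eraseCtx w)

eraseHom : ∀ {X Y} → S₁.Hom X Y → SG.Hom (eraseObj X) (eraseObj Y)
eraseHom {ob _ w} {ob Γ _} (hom σ ⊢σ) =
  SG.hom (eraseSub Γ σ) (⊢eraseSub (⊢eraseCtx w) ⊢σ)

ιObj : SG.Obj → S₁.Obj
ιObj (SG.ob Γ w) = ob (ιCtx Γ) (⊢ιCtx w)

ιHom : ∀ {X Y} → SG.Hom X Y → S₁.Hom (ιObj X) (ιObj Y)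
ιHom (SG.hom σ ⊢σ) = hom (ιSub σ) (⊢ιSub ⊢σ)

eraseHom-∘ : ∀ {Θ Δ Γ} (σ : S₁.Hom Δ Γ) (δ : S₁.Hom Θ Δ) →
             eraseSub (ctx Γ) (sub σ ∘s sub δ) ≡
             SG.sub (eraseHom σ) SG.∘s SG.sub (eraseHom δ)
eraseHom-∘ (hom _ ⊢σ) (hom _ ⊢δ) =
  recompute (≡-decSub G-≡-decTm _ _) (eraseSub-∘s ⊢δ ⊢σ)

eraseHom-[]ty : ∀ {Δ Γ A} (f : S₁.Hom Δ Γ) → .(ctx Γ ⊢ty A) →
                eraseTy (A [ sub f ]ty) ≡ eraseTy A G.[ SG.sub (eraseHom f) ]ty
eraseHom-[]ty (hom _ ⊢σ) ⊢A = recompute (G-≡-decTy _ _) (eraseTy-[] ⊢A ⊢σ)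

eraseHom-ιHom : ∀ {X Y} (σ : SG.Hom X Y) → SG.sub (eraseHom (ιHom σ)) ≡ SG.sub σ
eraseHom-ιHom (SG.hom _ ⊢σ) = recompute (≡-decSub G-≡-decTm _ _) (eraseSub-ιSub ⊢σ)

eraseObj-ιObj : (X : SG.Obj) → eraseObj (ιObj X) ≡ X
eraseObj-ιObj X = Obj-≡ (eraseCtx-ιCtx (SG.ctx X))

eraseHom-id : ∀ {Δ Γ} (i : S₁.Hom Δ Γ) → sub i ≡ idSub var (ctx Γ) →
              SG.sub (eraseHom i) ≡ idSub G.var (eraseCtx (ctx Γ))
eraseHom-id {Γ = Γ} i i≡id = trans (cong (eraseSub (ctx Γ)) i≡id) (eraseSub-idSub (ctx Γ))

module _ (M : SG.Model) where
  private module M = SG.Model M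

  -- Along a variable of type 𝟏 both display maps erase to identities.
  erase*-pullback :
    ∀ {Δ Γ : S₁.Obj} (x y : ℕ) (A : Ty) (f : S₁.Hom Δ Γ)
    (ΓA : S₁.Obj) → ctx ΓA ≡ (ctx Γ ▸ x ∶ A) →
    (ΔA : S₁.Obj) → ctx ΔA ≡ (ctx Δ ▸ y ∶ (A [ sub f ]ty)) →
    (pΓ : S₁.Hom ΓA Γ) → sub pΓ ≡ idSub var (ctx Γ) →
    (pΔ : S₁.Hom ΔA Δ) → sub pΔ ≡ idSub var (ctx Δ) →
    (q : S₁.Hom ΔA ΓA) → sub q ≡ ⟨ sub f , x ↦ var y ⟩ →
    S₁.IsSetPullback (M.F₁ (eraseHom q)) (M.F₁ (eraseHom pΔ))
                     (M.F₁ (eraseHom f)) (M.F₁ (eraseHom pΓ))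
  erase*-pullback x y 𝟏 f (ob _ _) refl (ob _ _) refl pΓ pΓ≡id pΔ pΔ≡id
                  q@(hom _ _) refl =
    identity-isSetPullback (M.F-id (eraseHom pΔ) (eraseHom-id pΔ pΔ≡id))
                           (M.F-id (eraseHom pΓ) (eraseHom-id pΓ pΓ≡id))
                           (M.F-resp {σ = eraseHom q} {τ = eraseHom f} refl)
  erase*-pullback x y (Hom B t u) f (ob _ wΓA) refl (ob _ _) refl pΓ pΓ≡id pΔ pΔ≡id
                  q@(hom _ _) refl =
    M.F-pullback x y (eraseTy (Hom B t u)) (eraseHom f)
      _ refl _ (cong (_ ▸ y ∶_) (eraseHom-[]ty f (▸⊢⇒⊢ty wΓA)))
      (eraseHom pΓ) (eraseHom-id pΓ pΓ≡id) (eraseHom pΔ) (eraseHom-id pΔ pΔ≡id)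
      (eraseHom q) refl

  erase*Model : S₁.Model
  erase*Model = record
    { F₀ = λ X → M.F₀ (eraseObj X)
    ; F₁ = λ f → M.F₁ (eraseHom f)
    ; F-resp = λ {_} {_} {σ} {τ} σ≐τ →
        M.F-resp {σ = eraseHom σ} {τ = eraseHom τ} (eraseSub-≐ σ≐τ)
    ; F-id = λ i i≡id → M.F-id (eraseHom i) (eraseHom-id i i≡id)
    ; F-comp = λ {_} {_} {Γ} σ δ h h≡σ∘δ → M.F-comp (eraseHom σ) (eraseHom δ) (eraseHom h)
        (trans (cong (eraseSub (ctx Γ)) h≡σ∘δ) (eraseHom-∘ σ δ))
    ; F-terminal = λ E E≡∅ → M.F-terminal (eraseObj E) (cong eraseCtx E≡∅)
    ; F-pullback = erase*-pullback
    }

ι*Model : S₁.Model → SG.Model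
ι*Model N = record
  { F₀ = λ X → N.F₀ (ιObj X)
  ; F₁ = λ f → N.F₁ (ιHom f)
  ; F-resp = λ {_} {_} {σ} {τ} σ≡τ a → cong (λ h → N.F₁ (ιHom h) a) (Hom-≡ {f = σ} {τ} σ≡τ)
  ; F-id = λ i i≡id → N.F-id (ιHom i) (ιHom-id i≡id)
  ; F-comp = λ σ δ h h≡σ∘δ → N.F-comp (ιHom σ) (ιHom δ) (ιHom h)
      (trans (cong ιSub h≡σ∘δ) (ιSub-∘s (SG.sub σ) (SG.sub δ)))
  ; F-terminal = λ E E≡∅ → N.F-terminal (ιObj E) (cong ιCtx E≡∅)
  ; F-pullback = λ {Δ} {Γ} x y A f ΓA ΓA≡ ΔA ΔA≡ pΓ pΓ≡id pΔ pΔ≡id q q≡ →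
      N.F-pullback x y (ιTy A) (ιHom f) (ιObj ΓA) (cong ιCtx ΓA≡) (ιObj ΔA)
        (trans (cong ιCtx ΔA≡) (cong (ιCtx (SG.ctx Δ) ▸ y ∶_) (ιTy-[] A (SG.sub f))))
        (ιHom pΓ) (ιHom-id pΓ≡id) (ιHom pΔ) (ιHom-id pΔ≡id) (ιHom q) (cong ιSub q≡)
  }
  where
    module N = S₁.Model N
    ιHom-id : ∀ {σ Γ} → σ ≡ idSub G.var Γ → ιSub σ ≡ idSub var (ιCtx Γ)
    ιHom-id {Γ = Γ} σ≡id = trans (cong ιSub σ≡id) (ιSub-idSub Γ)

erase* : Functor ModGlob ModGlob₁
erase* = record
  { F₀ = erase*Model
  ; F₁ = λ α → record
      { η = λ X → SG.η α (eraseObj X) ; nat = λ σ → SG.nat α (eraseHom σ) }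
  ; identity = λ _ _ → refl
  ; homomorphism = λ _ _ → refl
  ; F-resp-≈ = λ α≈β X → α≈β (eraseObj X)
  }

ι* : Functor ModGlob₁ ModGlob
ι* = record
  { F₀ = ι*Model
  ; F₁ = λ α → record
      { η = λ X → S₁.η α (ιObj X) ; nat = λ σ → S₁.nat α (ιHom σ) }
  ; identity = λ _ _ → refl
  ; homomorphism = λ _ _ → refl
  ; F-resp-≈ = λ α≈β X → α≈β (ιObj X)
  }

F₁-subst : (M : SG.Model) → let open SG.Model M in
           ∀ {X X′ Y Y′} (X≡X′ : X ≡ X′) (Y≡Y′ : Y ≡ Y′)
           (f : SG.Hom X Y) (g : SG.Hom X′ Y′) →
           SG.sub f ≡ SG.sub g → ∀ a → subst F₀ Y≡Y′ (F₁ f a) ≡ F₁ g (subst F₀ X≡X′ a)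
F₁-subst M refl refl f g f≡g a = cong (λ h → SG.Model.F₁ M h a) (Hom-≡ f≡g)

ι*∘erase*≅id : NaturalIsomorphism (ι* ∘F erase*) idF
ι*∘erase*≅id = record
  { η = λ M → record
      { η = λ X → subst (SG.Model.F₀ M) (eraseObj-ιObj X)
      ; nat = λ σ → F₁-subst M _ _ (eraseHom (ιHom σ)) σ (eraseHom-ιHom σ) }
  ; η⁻¹ = λ M → record
      { η = λ X → subst (SG.Model.F₀ M) (sym (eraseObj-ιObj X))
      ; nat = λ σ → F₁-subst M _ _ σ (eraseHom (ιHom σ)) (sym (eraseHom-ιHom σ)) }
  ; commute = λ α X _ → subst-application′ _ (SG.η α) (eraseObj-ιObj X)
  ; isoˡ = λ _ X _ → subst-sym-subst (eraseObj-ιObj X)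
  ; isoʳ = λ _ X _ → subst-subst-sym (eraseObj-ιObj X)
  }

-- Models see ι ∘ erase as the identity

πHom : (X : S₁.Obj) → S₁.Hom X (ιObj (eraseObj X))
πHom (ob Γ w) = hom (π Γ) (⊢π w)

ρHom : (X : S₁.Obj) → S₁.Hom (ιObj (eraseObj X)) X
ρHom (ob Γ w) = hom (ρ Γ) (⊢ρ w)

ιeraseHom : ∀ {X Y} → S₁.Hom X Y → S₁.Hom X (ιObj (eraseObj Y))
ιeraseHom {Y = ob Γ _} (hom σ ⊢σ) = hom (ιSub (eraseSub Γ σ)) (⊢ιeraseSub ⊢σ)

ιeraseHom≡πHom∘ : ∀ {X Y} (σ : S₁.Hom X Y) → sub (ιeraseHom σ) ≡ sub (πHom Y) ∘s sub σ
ιeraseHom≡πHom∘ {Y = ob _ _} (hom _ ⊢σ) =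
  recompute (≡-decSub ≡-decTm _ _) (ιSub-eraseSub ⊢σ)

πHom≡πHom∘ρHom : (X : S₁.Obj) → sub (πHom X) ≡ sub (πHom X) ∘s sub (ρHom X)
πHom≡πHom∘ρHom (ob _ w) = sym (recompute (≡-decSub ≡-decTm _ _) (π∘ρ≡π w))

display : ∀ {Γ x A} .(w : (Γ ▸ x ∶ A) ⊢) →
          S₁.Hom (ob (Γ ▸ x ∶ A) w) (ob Γ (▸⊢⇒⊢ w))
display w = hom (idSub var _) (⊢display w)

⊢∅▸𝟏 : ∀ {x} → (∅ ▸ x ∶ 𝟏) ⊢
⊢∅▸𝟏 = ▸-rule (𝟏-rule ∅-rule) fresh-∅

⊢retype : ∀ {Γ x A A′} → (Γ ▸ x ∶ A) ⊢ → (Γ ▸ x ∶ A′) ⊢ → Γ ⊢ A ≐ty A′ →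
          (Γ ▸ x ∶ A) ⊢s idSub var (Γ ▸ x ∶ A) ∶ (Γ ▸ x ∶ A′)
⊢retype {Γ} w w′ A≐A′ =
  ext-rule (⊢display w) w′
    (⊢∶-[identity] (idSub-isIdentity Γ) (conv-rule (var-rule w here) (wk≐ty w A≐A′)))

⊢▸ιeraseTy : ∀ {Γ x B t u} →
             (Γ ▸ x ∶ Hom B t u) ⊢ → (Γ ▸ x ∶ ιeraseTy (Hom B t u)) ⊢
⊢▸ιeraseTy (▸-rule ⊢A f) = ▸-rule (⊢ιeraseTy ⊢A) f

idHom : (X : S₁.Obj) → S₁.Hom X X
idHom (ob Γ w) = hom (idSub var Γ) (⊢idSub w)

module _ (N : S₁.Model) where
  open S₁.Model N
  open ≡-Reasoning

  F₁-square : ∀ {Θ Δ Δ′ Γ} (σ : S₁.Hom Δ Γ) (δ : S₁.Hom Θ Δ)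
              (σ′ : S₁.Hom Δ′ Γ) (δ′ : S₁.Hom Θ Δ′) (h : S₁.Hom Θ Γ) →
              sub h ≡ sub σ ∘s sub δ → sub h ≡ sub σ′ ∘s sub δ′ →
              ∀ a → F₁ σ (F₁ δ a) ≡ F₁ σ′ (F₁ δ′ a)
  F₁-square σ δ σ′ δ′ h h≡σ∘δ h≡σ′∘δ′ a =
    trans (sym (F-comp σ δ h h≡σ∘δ a)) (F-comp σ′ δ′ h h≡σ′∘δ′ a)

  F₁-retraction : ∀ {X Y} (σ : S₁.Hom Y X) (δ : S₁.Hom X Y) →
                  idSub var (ctx X) ≡ sub σ ∘s sub δ → ∀ a → F₁ σ (F₁ δ a) ≡ a
  F₁-retraction {X} σ δ id≡σ∘δ a =
    trans (sym (F-comp σ δ (idHom X) id≡σ∘δ a)) (F-id (idHom X) refl a)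

  F₀-∅-unique : ∀ .(w : ∅ ⊢) (a b : F₀ (ob ∅ w)) → a ≡ b
  F₀-∅-unique w a b with F-terminal (ob ∅ w) refl
  ... | _ , unique = trans (unique a) (sym (unique b))

  -- The identity of (x : 𝟏) is definitionally equal to ⟨x ↦ ()⟩, which
  -- factors through ∅.
  F₀-∅▸𝟏-unique : ∀ x (a b : F₀ (ob (∅ ▸ x ∶ 𝟏) ⊢∅▸𝟏)) → a ≡ b
  F₀-∅▸𝟏-unique x a b =
    trans (factor a) (trans (cong (F₁ pt) (F₀-∅-unique ∅-rule _ _)) (sym (factor b)))
    where
      X : S₁.Obj
      X = ob (∅ ▸ x ∶ 𝟏) ⊢∅▸𝟏
      pt : S₁.Hom (ob ∅ ∅-rule) X
      pt = hom ⟨ ⟨⟩ , x ↦ unit ⟩ (ext-rule (⟨⟩-rule ∅-rule) ⊢∅▸𝟏 (unit-rule ∅-rule))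
      ! : S₁.Hom X (ob ∅ ∅-rule)
      ! = hom ⟨⟩ (⟨⟩-rule ⊢∅▸𝟏)
      pt∘! : S₁.Hom X X
      pt∘! = hom ⟨ ⟨⟩ , x ↦ unit ⟩ (ext-rule (⟨⟩-rule ⊢∅▸𝟏) ⊢∅▸𝟏 (unit-rule ⊢∅▸𝟏))
      id : S₁.Hom X X
      id = hom ⟨ ⟨⟩ , x ↦ var x ⟩ (⊢idSub ⊢∅▸𝟏)
      id≐pt∘! : id S₁.≈ pt∘!
      id≐pt∘! = ext-≡ (⟨⟩-≡ ⊢∅▸𝟏) ⊢∅▸𝟏 (≡-η𝟏 (var-rule ⊢∅▸𝟏 here))
      factor : ∀ a → a ≡ F₁ pt (F₁ ! a)
      factor a = begin
        a                 ≡⟨ F-id id refl a ⟨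
        F₁ id a           ≡⟨ F-resp id≐pt∘! a ⟩
        F₁ pt∘! a         ≡⟨ F-comp pt ! pt∘! refl a ⟩
        F₁ pt (F₁ ! a)    ∎

  F₁π-injective-▸𝟏 : ∀ {Γ x} .(w : (Γ ▸ x ∶ 𝟏) ⊢) →
                     Injective _≡_ _≡_ (F₁ (πHom (ob Γ (▸⊢⇒⊢ w)))) →
                     Injective _≡_ _≡_ (F₁ (πHom (ob (Γ ▸ x ∶ 𝟏) w)))
  F₁π-injective-▸𝟏 {Γ} {x} w πΓ-injective {a} {b} πa≡πb =
    isSetPullback-jointlyInjective square (λ _ → F₀-∅-unique ∅-rule _ _)
      (πΓ-injective (trans (sym (π-factors a)) (trans πa≡πb (π-factors b))))
      (F₀-∅▸𝟏-unique x _ _)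
    where
      XΓ X∅▸𝟏 X : S₁.Obj
      XΓ = ob Γ (▸⊢⇒⊢ w)
      X∅▸𝟏 = ob (∅ ▸ x ∶ 𝟏) ⊢∅▸𝟏
      X = ob (Γ ▸ x ∶ 𝟏) w
      q : S₁.Hom X X∅▸𝟏
      q = hom ⟨ ⟨⟩ , x ↦ var x ⟩ (ext-rule (⟨⟩-rule w) ⊢∅▸𝟏 (var-rule w here))
      square : S₁.IsSetPullback (F₁ q) (F₁ (display w))
                 (F₁ (hom ⟨⟩ (⟨⟩-rule (▸⊢⇒⊢ w)))) (F₁ (hom ⟨⟩ (⟨⟩-rule ⊢∅▸𝟏)))
      square = F-pullback x x 𝟏 _ X∅▸𝟏 refl X refl _ refl (display w) refl q refl
      π-factors : ∀ z → F₁ (πHom X) z ≡ F₁ (πHom XΓ) (F₁ (display w) z)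
      π-factors = F-comp (πHom XΓ) (display w) (πHom X) (sym (∘s-idSubʳ Γ (π Γ)))

  F₁π-injective-▸Hom : ∀ {Γ x B t u} .(w : (Γ ▸ x ∶ Hom B t u) ⊢) →
                       Injective _≡_ _≡_ (F₁ (πHom (ob Γ (▸⊢⇒⊢ w)))) →
                       Injective _≡_ _≡_ (F₁ (πHom (ob (Γ ▸ x ∶ Hom B t u) w)))
  F₁π-injective-▸Hom {Γ} {x} {B} {t} {u} w πΓ-injective {a} {b} πa≡πb =
    retype-injective (q-injective (trans (sym (π-factors a)) (trans πa≡πb (π-factors b))))
    where
      A A′ : Ty
      A = Hom B t u
      A′ = ιeraseTy A
      XΓ XιΓ X XA′ XιA′ : S₁.Obj
      XΓ = ob Γ (▸⊢⇒⊢ w)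
      XιΓ = ob (ιerase Γ) (⊢ιerase (▸⊢⇒⊢ w))
      X = ob (Γ ▸ x ∶ A) w
      XA′ = ob (Γ ▸ x ∶ A′) (⊢▸ιeraseTy w)
      XιA′ = ob (ιerase Γ ▸ x ∶ A′) (⊢ιerase w)
      pΓ : S₁.Hom XιA′ XιΓ
      pΓ = display (⊢ιerase w)
      pΔ : S₁.Hom XA′ XΓ
      pΔ = display (⊢▸ιeraseTy w)
      q : S₁.Hom XA′ XιA′
      q = hom ⟨ π Γ , x ↦ var x ⟩
            (ext-rule (wkSub (⊢▸ιeraseTy w) (⊢π (▸⊢⇒⊢ w))) (⊢ιerase w)
              (⊢∶-[identity] (idSub-isIdentity (ιerase Γ)) (var-rule (⊢▸ιeraseTy w) here)))
      square : S₁.IsSetPullback (F₁ q) (F₁ pΔ) (F₁ (πHom XΓ)) (F₁ pΓ)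
      square = F-pullback x x A′ (πHom XΓ) XιA′ refl XA′
                 (cong (Γ ▸ x ∶_) (sym ([]ty-identity (idSub-isIdentity (ιerase Γ)) A′)))
                 pΓ refl pΔ refl q refl
      commutes : ∀ z → F₁ (πHom XΓ) (F₁ pΔ z) ≡ F₁ pΓ (F₁ q z)
      commutes = F₁-square (πHom XΓ) pΔ pΓ q (hom (π Γ) (wkSub (⊢▸ιeraseTy w) (⊢π (▸⊢⇒⊢ w))))
                   (sym (∘s-idSubʳ Γ (π Γ)))
                   (sym (∘s-identityʳ (isIdentity-ext x (idSub-isIdentity (ιerase Γ))) (π Γ)))
      q-injective : Injective _≡_ _≡_ (F₁ q)
      q-injective {z} {z′} qz≡qz′ =
        isSetPullback-jointlyInjective square commutes
          (πΓ-injective (trans (commutes z) (trans (cong (F₁ pΓ) qz≡qz′) (sym (commutes z′)))))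
          qz≡qz′
      retype : S₁.Hom X XA′
      retype = hom (idSub var (Γ ▸ x ∶ A))
                 (⊢retype w (⊢▸ιeraseTy w) (≐ty-ιeraseTy (▸⊢⇒⊢ty w)))
      retype⁻¹ : S₁.Hom XA′ X
      retype⁻¹ = hom (idSub var (Γ ▸ x ∶ A))
                   (⊢retype (⊢▸ιeraseTy w) w (≐ty-sym (≐ty-ιeraseTy (▸⊢⇒⊢ty w))))
      retype-injective : Injective _≡_ _≡_ (F₁ retype)
      retype-injective = inverseʳ⇒injective (F₁ retype)
        (strictlyInverseʳ⇒inverseʳ {f⁻¹ = F₁ retype⁻¹} (F₁ retype)
          (F₁-retraction retype⁻¹ retype (sym (∘s-idSubʳ (Γ ▸ x ∶ A) _))))
      π-factors : ∀ z → F₁ (πHom X) z ≡ F₁ q (F₁ retype z)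
      π-factors = F-comp q retype (πHom X) (sym (∘s-idSubʳ (Γ ▸ x ∶ A) _))

  F₁π-injective : ∀ Γ .(w : Γ ⊢) → Injective _≡_ _≡_ (F₁ (πHom (ob Γ w)))
  F₁π-injective ∅ w _ = F₀-∅-unique w _ _
  F₁π-injective (Γ ▸ x ∶ 𝟏) w = F₁π-injective-▸𝟏 w (F₁π-injective Γ (▸⊢⇒⊢ w))
  F₁π-injective (Γ ▸ x ∶ Hom _ _ _) w = F₁π-injective-▸Hom w (F₁π-injective Γ (▸⊢⇒⊢ w))

  F₁π∘F₁ρ≗id : ∀ X a → F₁ (πHom X) (F₁ (ρHom X) a) ≡ a
  F₁π∘F₁ρ≗id X = F₁-retraction (πHom X) (ρHom X) (πHom≡πHom∘ρHom X)

  F₁ρ∘F₁π≗id : ∀ X a → F₁ (ρHom X) (F₁ (πHom X) a) ≡ a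
  F₁ρ∘F₁π≗id X@(ob Γ w) a = F₁π-injective Γ w (F₁π∘F₁ρ≗id X (F₁ (πHom X) a))

  F₁π-natural : ∀ {X Y} (σ : S₁.Hom X Y) a →
                F₁ (πHom Y) (F₁ σ a) ≡ F₁ (ιHom (eraseHom σ)) (F₁ (πHom X) a)
  F₁π-natural {X@(ob Γ _)} {Y} σ =
    F₁-square (πHom Y) σ (ιHom (eraseHom σ)) (πHom X) (ιeraseHom σ) (ιeraseHom≡πHom∘ σ)
      (sym (∘s-idSubʳ (ιerase Γ) _))

  F₁ρ-natural : ∀ {X Y} (σ : S₁.Hom X Y) a →
                F₁ (ρHom Y) (F₁ (ιHom (eraseHom σ)) a) ≡ F₁ σ (F₁ (ρHom X) a)
  F₁ρ-natural {X} {Y} σ a = begin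
    F₁ (ρHom Y) (F₁ (ιHom (eraseHom σ)) a)
      ≡⟨ cong (F₁ (ρHom Y) ∘ F₁ (ιHom (eraseHom σ))) (F₁π∘F₁ρ≗id X a) ⟨
    F₁ (ρHom Y) (F₁ (ιHom (eraseHom σ)) (F₁ (πHom X) (F₁ (ρHom X) a)))
      ≡⟨ cong (F₁ (ρHom Y)) (F₁π-natural σ _) ⟨
    F₁ (ρHom Y) (F₁ (πHom Y) (F₁ σ (F₁ (ρHom X) a)))
      ≡⟨ F₁ρ∘F₁π≗id Y _ ⟩
    F₁ σ (F₁ (ρHom X) a)
      ∎

erase*∘ι*≅id : NaturalIsomorphism (erase* ∘F ι*) idF
erase*∘ι*≅id = record
  { η = λ N → record { η = λ X → S₁.Model.F₁ N (ρHom X) ; nat = F₁ρ-natural N }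
  ; η⁻¹ = λ N → record { η = λ X → S₁.Model.F₁ N (πHom X) ; nat = F₁π-natural N }
  ; commute = λ α X a → sym (S₁.nat α (ρHom X) a)
  ; isoˡ = F₁π∘F₁ρ≗id
  ; isoʳ = F₁ρ∘F₁π≗id
  }

mainTheorem3 : Equivalence ModGlob ModGlob₁
mainTheorem3 = record { F = erase* ; G = ι* ; F∘G≅id = erase*∘ι*≅id ; G∘F≅id = ι*∘erase*≅id }
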